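{- It is undecidable whether a propositional Hilbert-type calculus $\mathbf{C}$ is weakly sound for a given finite-valued logic $\mathbf{M}$; that is, there is no algorithm which, given a finite propositional language, a calculus $\mathbf{C}$ and a finite-valued logic $\mathbf{M}$ over it, decides whether $\mathrm{Thm}(\mathbf{C})\subseteq\mathrm{Taut}(\mathbf{M})$.
   Context: A propositional language has variables $X_1,X_2,\dots$ and finitely many connectives with fixed arities (0-ary connectives are constants). A substitution maps variables to formulas; $F\sigma$ is the result of simultaneously replacing each variable $X$ in $F$ by $\sigma(X)$. A propositional Hilbert-type calculus $\mathbf{C}$ consists of a finite set of axioms (formulas) and a finite set of rules, each rule having premises $A_1,\dots,A_n$ and a conclusion $C$ (formulas). A derivation is a finite sequence $F_1,\dots,F_s$ where each $F_i$ is either $A\sigma$ for an axiom $A$ and substitution $\sigma$, or is $C\sigma$ for a rule with premises $A_1,\dots,A_n$ and conclusion $C$ and a substitution $\sigma$ such that $A_1\sigma,\dots,A_n\sigma$ occur earlier in the sequence. $\mathrm{Thm}(\mathbf{C})$ is the set of last formulas of derivations. A finite-valued logic $\mathbf{M}$ consists of a finite set $V(\mathbf{M})$ of truth values, a subset $V^+(\mathbf{M})$ of designated values, and a truth function $V(\mathbf{M})^n\to V(\mathbf{M})$ for each $n$-ary connective; valuations map variables to truth values and extend to formulas; a tautology is a formula designated under every valuation, and $\mathrm{Taut}(\mathbf{M})$ is the set of tautologies. $\mathbf{C}$ is weakly sound for $\mathbf{M}$ if $\mathrm{Thm}(\mathbf{C})\subseteq\mathrm{Taut}(\mathbf{M})$.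 -}

module Defs where

open import Data.Nat using (ℕ; zero; suc; _+_; _<_)
open import Data.Fin using (Fin; toℕ)
open import Data.List using (List; []; _∷_; length; lookup; take; last; map; concatMap; allFin)
open import Data.List.Membership.Propositional using (_∈_)
open import Data.List.Relation.Unary.All using (All)
open import Data.Vec using (Vec; []; _∷_; toList)
open import Data.Bool using (Bool; true; false)
open import Data.Maybe using (Maybe; just)
open import Data.Product using (Σ; ∃; _×_; _,_)
open import Data.Sum using (_⊎_)
open import Relation.Binary.PropositionalEquality using (_≡_)
import Data.Empty

record Language : Set where
  field arities : List ℕ
  Connective : Set
  Connective = Fin (length arities)
  arity : Connective → ℕ
  arity c = lookup arities c
open Language public

-- Formulas over L; variables X_1, X_2, ... are represented as var 0, var 1, ...
data Formula (L : Language) : Set where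
  var : ℕ → Formula L
  app : (c : Connective L) → Vec (Formula L) (arity L c) → Formula L

Substitution : Language → Set
Substitution L = ℕ → Formula L

mutual
  _[_] : {L : Language} → Formula L → Substitution L → Formula L
  var x     [ σ ] = σ x
  app c fs  [ σ ] = app c (substVec fs σ)

  substVec : {L : Language} {n : ℕ} → Vec (Formula L) n → Substitution L → Vec (Formula L) n
  substVec []       σ = []
  substVec (f ∷ fs) σ = (f [ σ ]) ∷ substVec fs σ

record Rule (L : Language) : Set where
  field
    premises   : List (Formula L)
    conclusion : Formula L
open Rule public

record Calculus (L : Language) : Set where
  field
    axioms : List (Formula L)
    rules  : List (Rule L)
open Calculus public

Justified : {L : Language} → Calculus L → List (Formula L) → Formula L → Set
Justified {L} C earlier F =
  (Σ (Formula L) λ A → A ∈ axioms C × Σ (Substitution L) λ σ → F ≡ A [ σ ])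
  ⊎ (Σ (Rule L) λ r → r ∈ rules C × Σ (Substitution L) λ σ →
       (F ≡ conclusion r [ σ ]) × All (λ A → (A [ σ ]) ∈ earlier) (premises r))

IsDerivation : {L : Language} → Calculus L → List (Formula L) → Set
IsDerivation C fs = (i : Fin (length fs)) → Justified C (take (toℕ i) fs) (lookup fs i)

Thm : {L : Language} → Calculus L → Formula L → Set
Thm {L} C F = Σ (List (Formula L)) λ fs → IsDerivation C fs × last fs ≡ just F

record FVLogic (L : Language) : Set where
  field
    size       : ℕ
    designated : Fin size → Bool
    truthFun   : (c : Connective L) → Vec (Fin size) (arity L c) → Fin size
open FVLogic public

Valuation : {L : Language} → FVLogic L → Set
Valuation M = ℕ → Fin (size M)

mutual
  evalF : {L : Language} (M : FVLogic L) → Valuation M → Formula L → Fin (size M)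
  evalF M v (var x)    = v x
  evalF M v (app c fs) = truthFun M c (evalVec M v fs)

  evalVec : {L : Language} (M : FVLogic L) {n : ℕ} → Valuation M → Vec (Formula L) n → Vec (Fin (size M)) n
  evalVec M v []       = []
  evalVec M v (f ∷ fs) = evalF M v f ∷ evalVec M v fs

Taut : {L : Language} → FVLogic L → Formula L → Set
Taut M F = (v : Valuation M) → designated M (evalF M v F) ≡ true

WeaklySound : {L : Language} → Calculus L → FVLogic L → Set
WeaklySound C M = (F : _) → Thm C F → Taut M F

record Instance : Set where
  field
    lang  : Language
    calc  : Calculus lang
    logic : FVLogic lang
open Instance public

-- Model of computation: partial (mu-)recursive functions on ℕ,
-- with a relational (big-step) semantics.

data PR : ℕ → Set where
  zeroF : {n : ℕ} → PR n
  succF : PR 1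
  proj  : {n : ℕ} → Fin n → PR n
  comp  : {n m : ℕ} → PR m → Vec (PR n) m → PR n
  prec  : {n : ℕ} → PR n → PR (suc (suc n)) → PR (suc n)
  mu    : {n : ℕ} → PR (suc n) → PR n

mutual
  data Eval : {n : ℕ} → PR n → Vec ℕ n → ℕ → Set where
    ev-zero : {n : ℕ} {xs : Vec ℕ n} → Eval zeroF xs 0
    ev-succ : {x : ℕ} → Eval succF (x ∷ []) (suc x)
    ev-proj : {n : ℕ} {xs : Vec ℕ n} (i : Fin n) → Eval (proj i) xs (Data.Vec.lookup xs i)
    ev-comp : {n m : ℕ} {f : PR m} {gs : Vec (PR n) m} {xs : Vec ℕ n} {ys : Vec ℕ m} {y : ℕ} →
              EvalAll gs xs ys → Eval f ys y → Eval (comp f gs) xs y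
    ev-prec0 : {n : ℕ} {g : PR n} {s : PR (suc (suc n))} {xs : Vec ℕ n} {y : ℕ} →
               Eval g xs y → Eval (prec g s) (0 ∷ xs) y
    ev-precS : {n : ℕ} {g : PR n} {s : PR (suc (suc n))} {xs : Vec ℕ n} {k y z : ℕ} →
               Eval (prec g s) (k ∷ xs) y → Eval s (k ∷ y ∷ xs) z → Eval (prec g s) (suc k ∷ xs) z
    ev-mu : {n : ℕ} {f : PR (suc n)} {xs : Vec ℕ n} {y : ℕ} →
            Eval f (y ∷ xs) 0 →
            ((z : ℕ) → z < y → Σ ℕ λ w → Eval f (z ∷ xs) (suc w)) →
            Eval (mu f) xs y

  data EvalAll : {n m : ℕ} → Vec (PR n) m → Vec ℕ n → Vec ℕ m → Set where
    ev-[] : {n : ℕ} {xs : Vec ℕ n} → EvalAll [] xs []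
    ev-∷  : {n m : ℕ} {g : PR n} {gs : Vec (PR n) m} {xs : Vec ℕ n} {y : ℕ} {ys : Vec ℕ m} →
            Eval g xs y → EvalAll gs xs ys → EvalAll (g ∷ gs) xs (y ∷ ys)

-- Gödel numbering of instances (Cantor pairing)

tri : ℕ → ℕ
tri zero    = zero
tri (suc n) = suc n + tri n

pair : ℕ → ℕ → ℕ
pair a b = tri (a + b) + b

encList : List ℕ → ℕ
encList []       = 0
encList (x ∷ xs) = suc (pair x (encList xs))

mutual
  encFormula : {L : Language} → Formula L → ℕ
  encFormula (var x)    = encList (0 ∷ x ∷ [])
  encFormula (app c fs) = encList (1 ∷ toℕ c ∷ encFormulas fs)

  encFormulas : {L : Language} {n : ℕ} → Vec (Formula L) n → List ℕ
  encFormulas []       = []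
  encFormulas (f ∷ fs) = encFormula f ∷ encFormulas fs

encRule : {L : Language} → Rule L → ℕ
encRule r = encList (encList (map encFormula (premises r)) ∷ encFormula (conclusion r) ∷ [])

encCalculus : {L : Language} → Calculus L → ℕ
encCalculus C = encList (encList (map encFormula (axioms C)) ∷ encList (map encRule (rules C)) ∷ [])

allVecs : (k n : ℕ) → List (Vec (Fin k) n)
allVecs k zero    = [] ∷ []
allVecs k (suc n) = concatMap (λ x → map (x ∷_) (allVecs k n)) (allFin k)

encBool : Bool → ℕ
encBool false = 0
encBool true  = 1

encLogic : {L : Language} → FVLogic L → ℕ
encLogic {L} M =
  encList (size M
          ∷ encList (map (λ x → encBool (designated M x)) (allFin (size M)))
          ∷ encList (map (λ c → encList (map (λ xs → toℕ (truthFun M c xs)) (allVecs (size M) (arity L c))))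
                         (allFin (length (arities L))))
          ∷ [])

code : Instance → ℕ
code I = encList (encList (arities (lang I)) ∷ encCalculus (calc I) ∷ encLogic (logic I) ∷ [])

DecidesWeakSoundness : PR 1 → Set
DecidesWeakSoundness d = (I : Instance) →
  (WeaklySound (calc I) (logic I) → Eval d (code I ∷ []) 0)
  × ((WeaklySound (calc I) (logic I) → Data.Empty.⊥) → Eval d (code I ∷ []) 1)

-- Diagonalisation. For a program d, the calculus C_d below simulates on quoted objects (numerals,
-- trees, programs) the Cantor coding of instances and the big-step semantics of partial recursive
-- functions. Its axiom quotes its own rules, from which it computes the code of the instance
-- (C_d, M) and derives the constant BAD exactly when d outputs 0 on that code; in the two-valued
-- logic M every formula other than BAD is a tautology. Every theorem of C_d is true under this
-- reading. If d decided weak soundness, soundness would make d output 0 and so BAD a theorem,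
-- while unsoundness would make d output 1, so that BAD is not a theorem and C_d is sound.

module Submission where

open import Defs
open import Data.Bool using (true; false)
open import Data.Empty using (⊥; ⊥-elim)
open import Data.Fin using (Fin; toℕ; zero; suc)
open import Data.List using (List; []; _∷_; _++_; _∷ʳ_; length; lookup; take; last; map; tabulate; allFin)
open import Data.List.Membership.Propositional using (_∈_)
open import Data.List.Membership.Propositional.Properties using (∈-++⁺ʳ; ∈-tabulate⁺; ∈-tabulate⁻)
open import Data.List.Properties using (++-assoc; ++-identityʳ; map-cong; map-id)
open import Data.List.Relation.Binary.Subset.Propositional using (_⊆_)
open import Data.List.Relation.Binary.Subset.Propositional.Properties using (++⁺ˡ; xs⊆xs++ys; xs⊆ys++xs)
open import Data.List.Relation.Unary.All as All using (All; []; _∷_)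
open import Data.List.Relation.Unary.All.Properties using (∷ʳ⁺)
open import Data.List.Relation.Unary.Any using (here; there)
open import Data.Maybe using (just)
open import Data.Nat using (ℕ; zero; suc; _+_; _<_; _≤_)
open import Data.Nat.Properties using (0≢1+n; 1+n≢0; <-cmp; ≤-refl; <⇒≤; m<1+n⇒m<n∨m≡n)
open import Data.Product using (Σ; ∃-syntax; _×_; _,_; proj₁; proj₂)
open import Data.Sum using (inj₁; inj₂)
open import Data.Unit using (⊤; tt)
open import Data.Vec using (Vec; []; _∷_)
import Data.Vec as Vec
open import Function using (_∘_)
open import Relation.Binary using (tri<; tri≈; tri>)
open import Relation.Binary.PropositionalEquality using (_≡_; _≢_; refl; sym; trans; cong; cong₂; subst)
open import Relation.Nullary using (¬_)

module _ {L : Language} (C : Calculus L) where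

  data Derivable : Formula L → Set where
    by-axiom : ∀ {A} → A ∈ axioms C → (σ : Substitution L) → Derivable (A [ σ ])
    by-rule  : ∀ {r} → r ∈ rules C → (σ : Substitution L) →
               All (λ A → Derivable (A [ σ ])) (premises r) → Derivable (conclusion r [ σ ])

  Chain : List (Formula L) → List (Formula L) → Set
  Chain pre []       = ⊤
  Chain pre (f ∷ fs) = Justified C pre f × Chain (pre ∷ʳ f) fs

  Justified-mono : ∀ {pre pre′ F} → pre ⊆ pre′ → Justified C pre F → Justified C pre′ F
  Justified-mono pre⊆ (inj₁ byAxiom) = inj₁ byAxiom
  Justified-mono pre⊆ (inj₂ (r , r∈ , σ , refl , ps∈)) = inj₂ (r , r∈ , σ , refl , All.map pre⊆ ps∈)

  Chain-mono : ∀ {pre pre′} fs → pre ⊆ pre′ → Chain pre fs → Chain pre′ fs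
  Chain-mono []       pre⊆ _          = tt
  Chain-mono (f ∷ fs) pre⊆ (j , chain) = Justified-mono pre⊆ j , Chain-mono fs (++⁺ˡ (f ∷ []) pre⊆) chain

  Chain-++ : ∀ pre fs gs → Chain pre fs → Chain (pre ++ fs) gs → Chain pre (fs ++ gs)
  Chain-++ pre []       gs _            chain = subst (λ p → Chain p gs) (++-identityʳ pre) chain
  Chain-++ pre (f ∷ fs) gs (j , chain₁) chain₂ =
    j , Chain-++ (pre ∷ʳ f) fs gs chain₁ (subst (λ p → Chain p gs) (sym (++-assoc pre (f ∷ []) fs)) chain₂)

  Chain-∷ʳ : ∀ pre fs {F} → Chain pre fs → Justified C (pre ++ fs) F → Chain pre (fs ∷ʳ F)
  Chain-∷ʳ pre fs chain j = Chain-++ pre fs _ chain (j , tt)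

  Chain⇒justified : ∀ pre fs → Chain pre fs →
                    (i : Fin (length fs)) → Justified C (pre ++ take (toℕ i) fs) (lookup fs i)
  Chain⇒justified pre (f ∷ fs) (j , chain) zero =
    subst (λ p → Justified C p f) (sym (++-identityʳ pre)) j
  Chain⇒justified pre (f ∷ fs) (j , chain) (suc i) =
    subst (λ p → Justified C p (lookup fs i)) (++-assoc pre (f ∷ []) (take (toℕ i) fs))
          (Chain⇒justified (pre ∷ʳ f) fs chain i)

  justified⇒Chain : ∀ pre fs → ((i : Fin (length fs)) → Justified C (pre ++ take (toℕ i) fs) (lookup fs i)) →
                    Chain pre fs
  justified⇒Chain pre []       _ = tt
  justified⇒Chain pre (f ∷ fs) js =
    subst (λ p → Justified C p f) (++-identityʳ pre) (js zero) ,
    justified⇒Chain (pre ∷ʳ f) fs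
      (λ i → subst (λ p → Justified C p (lookup fs i)) (sym (++-assoc pre (f ∷ []) (take (toℕ i) fs))) (js (suc i)))

  last-∷ʳ : ∀ (fs : List (Formula L)) F → last (fs ∷ʳ F) ≡ just F
  last-∷ʳ []           F = refl
  last-∷ʳ (_ ∷ [])     F = refl
  last-∷ʳ (_ ∷ g ∷ fs) F = last-∷ʳ (g ∷ fs) F

  last⇒∈ : ∀ (fs : List (Formula L)) {F} → last fs ≡ just F → F ∈ fs
  last⇒∈ (f ∷ [])     refl = here refl
  last⇒∈ (f ∷ g ∷ fs) eq   = there (last⇒∈ (g ∷ fs) eq)

  mutual
    derivable⇒Chain : ∀ {F} → Derivable F → ∃[ fs ] Chain [] fs × Justified C fs F
    derivable⇒Chain (by-axiom A∈ σ)   = [] , tt , inj₁ (_ , A∈ , σ , refl)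
    derivable⇒Chain (by-rule r∈ σ ds) with derivables⇒Chain ds
    ... | fs , chain , ps∈ = fs , chain , inj₂ (_ , r∈ , σ , refl , ps∈)

    derivables⇒Chain : ∀ {σ ps} → All (λ A → Derivable (A [ σ ])) ps →
                       ∃[ fs ] Chain [] fs × All (λ A → (A [ σ ]) ∈ fs) ps
    derivables⇒Chain []       = [] , tt , []
    derivables⇒Chain {σ} (_∷_ {A} d ds) with derivable⇒Chain d | derivables⇒Chain ds
    ... | fs , chain , j | gs , chain′ , ps∈ =
      let fs′ = fs ∷ʳ (A [ σ ]) in
      fs′ ++ gs ,
      Chain-++ [] fs′ gs (Chain-∷ʳ [] fs chain j) (Chain-mono gs (λ ()) chain′) ,
      xs⊆xs++ys fs′ gs (∈-++⁺ʳ fs (here refl)) ∷ All.map (xs⊆ys++xs gs fs′) ps∈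

  derivable⇒Thm : ∀ {F} → Derivable F → Thm C F
  derivable⇒Thm {F} d with derivable⇒Chain d
  ... | fs , chain , j =
    fs ∷ʳ F , Chain⇒justified [] (fs ∷ʳ F) (Chain-∷ʳ [] fs chain j) , last-∷ʳ fs F

  justified⇒derivable : ∀ {pre F} → All Derivable pre → Justified C pre F → Derivable F
  justified⇒derivable ds (inj₁ (A , A∈ , σ , refl))           = by-axiom A∈ σ
  justified⇒derivable ds (inj₂ (r , r∈ , σ , refl , ps∈)) = by-rule r∈ σ (All.map (All.lookup ds) ps∈)

  Chain⇒derivable : ∀ {pre} fs → All Derivable pre → Chain pre fs → All Derivable fs
  Chain⇒derivable []       ds _           = []
  Chain⇒derivable (f ∷ fs) ds (j , chain) =
    let d = justified⇒derivable ds j in d ∷ Chain⇒derivable fs (∷ʳ⁺ ds d) chain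

  Thm⇒derivable : ∀ {F} → Thm C F → Derivable F
  Thm⇒derivable (fs , isDerivation , last≡F) =
    All.lookup (Chain⇒derivable fs [] (justified⇒Chain [] fs isDerivation)) (last⇒∈ fs last≡F)

mutual
  Eval-deterministic : ∀ {n} {f : PR n} {xs y y′} → Eval f xs y → Eval f xs y′ → y ≡ y′
  Eval-deterministic ev-zero        ev-zero          = refl
  Eval-deterministic ev-succ        ev-succ          = refl
  Eval-deterministic (ev-proj i)    (ev-proj .i)     = refl
  Eval-deterministic (ev-comp gs f) (ev-comp gs′ f′) with EvalAll-deterministic gs gs′
  ... | refl = Eval-deterministic f f′
  Eval-deterministic (ev-prec0 g)   (ev-prec0 g′)    = Eval-deterministic g g′
  Eval-deterministic (ev-precS r s) (ev-precS r′ s′) with Eval-deterministic r r′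
  ... | refl = Eval-deterministic s s′
  Eval-deterministic (ev-mu {y = y} f₀ below) (ev-mu {y = y′} f₀′ below′) with <-cmp y y′
  ... | tri< y<y′ _ _ = ⊥-elim (0≢1+n (Eval-deterministic f₀ (proj₂ (below′ y y<y′))))
  ... | tri≈ _ y≡y′ _ = y≡y′
  ... | tri> _ _ y′<y = ⊥-elim (1+n≢0 (Eval-deterministic (proj₂ (below y′ y′<y)) f₀′))

  EvalAll-deterministic : ∀ {n m} {gs : Vec (PR n) m} {xs ys ys′} →
                          EvalAll gs xs ys → EvalAll gs xs ys′ → ys ≡ ys′
  EvalAll-deterministic ev-[]       ev-[]         = refl
  EvalAll-deterministic (ev-∷ g gs) (ev-∷ g′ gs′) =
    cong₂ _∷_ (Eval-deterministic g g′) (EvalAll-deterministic gs gs′)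

-- The codes of Defs are values of such trees; the calculus computes a code by building its tree.
data Tree : Set where
  leaf : ℕ → Tree
  node : List Tree → Tree

mutual
  value : Tree → ℕ
  value (leaf n)  = n
  value (node ts) = encList (values ts)

  values : List Tree → List ℕ
  values []       = []
  values (t ∷ ts) = value t ∷ values ts

values-map : ∀ {A : Set} (f : A → Tree) xs → values (map f xs) ≡ map (value ∘ f) xs
values-map f []       = refl
values-map f (x ∷ xs) = cong (value (f x) ∷_) (values-map f xs)

value-node-map : ∀ {A : Set} (f : A → Tree) {g : A → ℕ} → (∀ x → value (f x) ≡ g x) →
                 ∀ xs → value (node (map f xs)) ≡ encList (map g xs)
value-node-map f f≗g xs = cong encList (trans (values-map f xs) (map-cong f≗g xs))

natsTree : List ℕ → Tree
natsTree xs = node (map leaf xs)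

value-natsTree : ∀ xs → value (natsTree xs) ≡ encList xs
value-natsTree xs = trans (value-node-map leaf (λ _ → refl) xs) (cong encList (map-id xs))

module _ {L : Language} where

  mutual
    formulaTree : Formula L → Tree
    formulaTree (var x)    = node (leaf 0 ∷ leaf x ∷ [])
    formulaTree (app c fs) = node (leaf 1 ∷ leaf (toℕ c) ∷ argTrees fs)

    argTrees : ∀ {n} → Vec (Formula L) n → List Tree
    argTrees []       = []
    argTrees (f ∷ fs) = formulaTree f ∷ argTrees fs

  mutual
    value-formulaTree : ∀ F → value (formulaTree F) ≡ encFormula F
    value-formulaTree (var x)    = refl
    value-formulaTree (app c fs) = cong (λ ns → encList (1 ∷ toℕ c ∷ ns)) (values-argTrees fs)

    values-argTrees : ∀ {n} (fs : Vec (Formula L) n) → values (argTrees fs) ≡ encFormulas fs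
    values-argTrees []       = refl
    values-argTrees (f ∷ fs) = cong₂ _∷_ (value-formulaTree f) (values-argTrees fs)

  ruleTree : Rule L → Tree
  ruleTree r = node (node (map formulaTree (premises r)) ∷ formulaTree (conclusion r) ∷ [])

  value-ruleTree : ∀ r → value (ruleTree r) ≡ encRule r
  value-ruleTree r = cong₂ (λ ps c → encList (ps ∷ c ∷ []))
    (value-node-map formulaTree value-formulaTree (premises r)) (value-formulaTree (conclusion r))

  calculusTree : Calculus L → Tree
  calculusTree C = node (node (map formulaTree (axioms C)) ∷ node (map ruleTree (rules C)) ∷ [])

  value-calculusTree : ∀ C → value (calculusTree C) ≡ encCalculus C
  value-calculusTree C = cong₂ (λ as rs → encList (as ∷ rs ∷ []))
    (value-node-map formulaTree value-formulaTree (axioms C)) (value-node-map ruleTree value-ruleTree (rules C))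

  logicTree : FVLogic L → Tree
  logicTree M = node (leaf (size M)
                    ∷ natsTree (map (encBool ∘ designated M) (allFin (size M)))
                    ∷ node (map truthTable (allFin (length (arities L))))
                    ∷ [])
    where
    truthTable : Connective L → Tree
    truthTable c = natsTree (map (toℕ ∘ truthFun M c) (allVecs (size M) (arity L c)))

  value-logicTree : ∀ M → value (logicTree M) ≡ encLogic M
  value-logicTree M = cong₂ (λ ds ts → encList (size M ∷ ds ∷ ts ∷ []))
    (value-natsTree (map (encBool ∘ designated M) (allFin (size M))))
    (value-node-map _ (λ c → value-natsTree (map (toℕ ∘ truthFun M c) (allVecs (size M) (arity L c))))
                    (allFin (length (arities L))))

instanceTree : Instance → Tree
instanceTree I = node (natsTree (arities (lang I)) ∷ calculusTree (calc I) ∷ logicTree (logic I) ∷ [])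

value-instanceTree : ∀ I → value (instanceTree I) ≡ code I
value-instanceTree I = trans
  (cong (λ a → encList (a ∷ value (calculusTree (calc I)) ∷ value (logicTree (logic I)) ∷ []))
        (value-natsTree (arities (lang I))))
  (cong₂ (λ c l → encList (encList (arities (lang I)) ∷ c ∷ l ∷ []))
         (value-calculusTree (calc I)) (value-logicTree (logic I)))

-- The arities of #BAD, #Z, …, #Below below; BAD comes first so that Mbad can single it out.
Lg : Language
Lg = record { arities = 0 ∷ 0 ∷ 1 ∷ 0 ∷ 2 ∷ 1 ∷ 1 ∷ 1 ∷ 2 ∷ 3 ∷ 2 ∷ 3 ∷ 2 ∷ 2 ∷ 0 ∷ 0 ∷ 1 ∷ 2 ∷ 2 ∷ 1 ∷ 3 ∷ 3 ∷ 3 ∷ 3 ∷ [] }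

Fm : Set
Fm = Formula Lg

pattern #BAD    = zero
pattern #Z      = suc #BAD
pattern #S      = suc #Z
pattern #Nil    = suc #S
pattern #Cons   = suc #Nil
pattern #Lf     = suc #Cons
pattern #Nd     = suc #Lf
pattern #Self   = suc #Nd
pattern #Enc    = suc #Self
pattern #Add    = suc #Enc
pattern #Tri    = suc #Add
pattern #Pair   = suc #Tri
pattern #Val    = suc #Pair
pattern #Vals   = suc #Val
pattern #Zf     = suc #Vals
pattern #Sf     = suc #Zf
pattern #Pj     = suc #Sf
pattern #Cp     = suc #Pj
pattern #Pr     = suc #Cp
pattern #Mu     = suc #Pr
pattern #Ev     = suc #Mu
pattern #Evs    = suc #Ev
pattern #Lookup = suc #Evs
pattern #Below  = suc #Lookup

pattern BADₒ             = app #BAD []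
pattern Zₒ               = app #Z []
pattern Sₒ n             = app #S (n ∷ [])
pattern Nilₒ             = app #Nil []
pattern Consₒ x xs       = app #Cons (x ∷ xs ∷ [])
pattern Lfₒ n            = app #Lf (n ∷ [])
pattern Ndₒ ts           = app #Nd (ts ∷ [])
pattern Selfₒ ts         = app #Self (ts ∷ [])
pattern Encₒ F t         = app #Enc (F ∷ t ∷ [])
pattern Addₒ m n k       = app #Add (m ∷ n ∷ k ∷ [])
pattern Triₒ m k         = app #Tri (m ∷ k ∷ [])
pattern Pairₒ m n k      = app #Pair (m ∷ n ∷ k ∷ [])
pattern Valₒ t n         = app #Val (t ∷ n ∷ [])
pattern Valsₒ ts n       = app #Vals (ts ∷ n ∷ [])
pattern Zfₒ              = app #Zf []
pattern Sfₒ              = app #Sf []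
pattern Pjₒ i            = app #Pj (i ∷ [])
pattern Cpₒ f gs         = app #Cp (f ∷ gs ∷ [])
pattern Prₒ g s          = app #Pr (g ∷ s ∷ [])
pattern Muₒ f            = app #Mu (f ∷ [])
pattern Evₒ f xs y       = app #Ev (f ∷ xs ∷ y ∷ [])
pattern Evsₒ gs xs ys    = app #Evs (gs ∷ xs ∷ ys ∷ [])
pattern Lookupₒ xs i y   = app #Lookup (xs ∷ i ∷ y ∷ [])
pattern Belowₒ f xs y    = app #Below (f ∷ xs ∷ y ∷ [])

⌜_⌝ₙ : ℕ → Fm
⌜ zero ⌝ₙ  = Zₒ
⌜ suc n ⌝ₙ = Sₒ ⌜ n ⌝ₙ

⌜_⌝ᵥ : ∀ {n} → Vec ℕ n → Fm
⌜ [] ⌝ᵥ     = Nilₒ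
⌜ x ∷ xs ⌝ᵥ = Consₒ ⌜ x ⌝ₙ ⌜ xs ⌝ᵥ

mutual
  ⌜_⌝ₜ : Tree → Fm
  ⌜ leaf n ⌝ₜ  = Lfₒ ⌜ n ⌝ₙ
  ⌜ node ts ⌝ₜ = Ndₒ ⌜ ts ⌝ₜₛ

  ⌜_⌝ₜₛ : List Tree → Fm
  ⌜ [] ⌝ₜₛ     = Nilₒ
  ⌜ t ∷ ts ⌝ₜₛ = Consₒ ⌜ t ⌝ₜ ⌜ ts ⌝ₜₛ

mutual
  ⌜_⌝ₚ : ∀ {n} → PR n → Fm
  ⌜ zeroF ⌝ₚ     = Zfₒ
  ⌜ succF ⌝ₚ     = Sfₒ
  ⌜ proj i ⌝ₚ    = Pjₒ ⌜ toℕ i ⌝ₙ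
  ⌜ comp f gs ⌝ₚ = Cpₒ ⌜ f ⌝ₚ ⌜ gs ⌝ₚₛ
  ⌜ prec g s ⌝ₚ  = Prₒ ⌜ g ⌝ₚ ⌜ s ⌝ₚ
  ⌜ mu f ⌝ₚ      = Muₒ ⌜ f ⌝ₚ

  ⌜_⌝ₚₛ : ∀ {n m} → Vec (PR n) m → Fm
  ⌜ [] ⌝ₚₛ     = Nilₒ
  ⌜ g ∷ gs ⌝ₚₛ = Consₒ ⌜ g ⌝ₚ ⌜ gs ⌝ₚₛ

Closed : Fm → Set
Closed F = ∀ σ → F [ σ ] ≡ F

⌜⌝ₙ-closed : ∀ n → Closed ⌜ n ⌝ₙ
⌜⌝ₙ-closed zero    σ = refl
⌜⌝ₙ-closed (suc n) σ = cong Sₒ (⌜⌝ₙ-closed n σ)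

mutual
  ⌜⌝ₜ-closed : ∀ t → Closed ⌜ t ⌝ₜ
  ⌜⌝ₜ-closed (leaf n)  σ = cong Lfₒ (⌜⌝ₙ-closed n σ)
  ⌜⌝ₜ-closed (node ts) σ = cong Ndₒ (⌜⌝ₜₛ-closed ts σ)

  ⌜⌝ₜₛ-closed : ∀ ts → Closed ⌜ ts ⌝ₜₛ
  ⌜⌝ₜₛ-closed []       σ = refl
  ⌜⌝ₜₛ-closed (t ∷ ts) σ = cong₂ Consₒ (⌜⌝ₜ-closed t σ) (⌜⌝ₜₛ-closed ts σ)

mutual
  ⌜⌝ₚ-closed : ∀ {n} (f : PR n) → Closed ⌜ f ⌝ₚ
  ⌜⌝ₚ-closed zeroF       σ = refl
  ⌜⌝ₚ-closed succF       σ = refl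
  ⌜⌝ₚ-closed (proj i)    σ = cong Pjₒ (⌜⌝ₙ-closed (toℕ i) σ)
  ⌜⌝ₚ-closed (comp f gs) σ = cong₂ Cpₒ (⌜⌝ₚ-closed f σ) (⌜⌝ₚₛ-closed gs σ)
  ⌜⌝ₚ-closed (prec g s)  σ = cong₂ Prₒ (⌜⌝ₚ-closed g σ) (⌜⌝ₚ-closed s σ)
  ⌜⌝ₚ-closed (mu f)      σ = cong Muₒ (⌜⌝ₚ-closed f σ)

  ⌜⌝ₚₛ-closed : ∀ {n m} (gs : Vec (PR n) m) → Closed ⌜ gs ⌝ₚₛ
  ⌜⌝ₚₛ-closed []       σ = refl
  ⌜⌝ₚₛ-closed (g ∷ gs) σ = cong₂ Consₒ (⌜⌝ₚ-closed g σ) (⌜⌝ₚₛ-closed gs σ)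

Mbad : FVLogic Lg
Mbad = record
  { size       = 2
  ; designated = λ { zero → false ; (suc _) → true }
  ; truthFun   = λ { #BAD _ → zero ; (suc _) _ → suc zero }
  }

BAD-undesignated : ∀ v → designated Mbad (evalF Mbad v BADₒ) ≢ true
BAD-undesignated v ()

-- ⌜ formulaTree (app c Fs) ⌝ₜ, given the quoted trees ts of the arguments Fs.
appNode : Connective Lg → Fm → Fm
appNode c ts = Ndₒ (Consₒ (Lfₒ ⌜ 1 ⌝ₙ) (Consₒ (Lfₒ ⌜ toℕ c ⌝ₙ) ts))

instanceTemplate : Fm → Fm → Fm
instanceTemplate a rs =
  Ndₒ (Consₒ ⌜ natsTree (arities Lg) ⌝ₜ (Consₒ (Ndₒ (Consₒ (Ndₒ (Consₒ a Nilₒ)) (Consₒ (Ndₒ rs) Nilₒ)))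
                                       (Consₒ ⌜ logicTree Mbad ⌝ₜ Nilₒ)))

instanceTemplate-[] : ∀ a rs σ → instanceTemplate a rs [ σ ] ≡ instanceTemplate (a [ σ ]) (rs [ σ ])
instanceTemplate-[] a rs σ = cong₂
  (λ ars lg → Ndₒ (Consₒ ars (Consₒ (Ndₒ (Consₒ (Ndₒ (Consₒ (a [ σ ]) Nilₒ)) (Consₒ (Ndₒ (rs [ σ ])) Nilₒ)))
                             (Consₒ lg Nilₒ))))
  (⌜⌝ₜ-closed (natsTree (arities Lg)) σ) (⌜⌝ₜ-closed (logicTree Mbad) σ)

_⟹_ : List Fm → Fm → Rule Lg
ps ⟹ c = record { premises = ps ; conclusion = c }
infix 4 _⟹_

X₀ X₁ X₂ X₃ X₄ X₅ : Fm
X₀ = var 0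
X₁ = var 1
X₂ = var 2
X₃ = var 3
X₄ = var 4
X₅ = var 5

-- Variables beyond the list are sent to an arbitrary closed formula.
assign : List Fm → Substitution Lg
assign []       _       = Zₒ
assign (F ∷ Fs) zero    = F
assign (F ∷ Fs) (suc x) = assign Fs x

pattern encZ     = zero
pattern encS     = suc encZ
pattern encNil   = suc encS
pattern encCons  = suc encNil
pattern encLf    = suc encCons
pattern encNd    = suc encLf
pattern encSelf  = suc encNd
pattern addZ     = suc encSelf
pattern addS     = suc addZ
pattern triZ     = suc addS
pattern triS     = suc triZ
pattern pairing  = suc triS
pattern valLf    = suc pairing
pattern valNd    = suc valLf
pattern valsNil  = suc valNd
pattern valsCons = suc valsNil
pattern evZf     = suc valsCons
pattern evSf     = suc evZf
pattern evPj     = suc evSf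
pattern evCp     = suc evPj
pattern evPr0    = suc evCp
pattern evPrS    = suc evPr0
pattern evMu     = suc evPrS
pattern evsNil   = suc evMu
pattern evsCons  = suc evsNil
pattern lookupZ  = suc evsCons
pattern lookupS  = suc lookupZ
pattern belowZ   = suc lookupS
pattern belowS   = suc belowZ
pattern diagonal = suc belowS

NonZeroBelow : ∀ {n} → PR (suc n) → Vec ℕ n → ℕ → Set
NonZeroBelow f xs y = ∀ z → z < y → ∃[ w ] Eval f (z ∷ xs) (suc w)

module Diagonal (d : PR 1) where

  rule : Fin 30 → Rule Lg
  rule encZ     = [] ⟹ Encₒ Zₒ (appNode #Z Nilₒ)
  rule encS     = Encₒ X₀ X₁ ∷ [] ⟹ Encₒ (Sₒ X₀) (appNode #S (Consₒ X₁ Nilₒ))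
  rule encNil   = [] ⟹ Encₒ Nilₒ (appNode #Nil Nilₒ)
  rule encCons  = Encₒ X₀ X₂ ∷ Encₒ X₁ X₃ ∷ [] ⟹ Encₒ (Consₒ X₀ X₁) (appNode #Cons (Consₒ X₂ (Consₒ X₃ Nilₒ)))
  rule encLf    = Encₒ X₀ X₁ ∷ [] ⟹ Encₒ (Lfₒ X₀) (appNode #Lf (Consₒ X₁ Nilₒ))
  rule encNd    = Encₒ X₀ X₁ ∷ [] ⟹ Encₒ (Ndₒ X₀) (appNode #Nd (Consₒ X₁ Nilₒ))
  rule encSelf  = Encₒ X₀ X₁ ∷ [] ⟹ Encₒ (Selfₒ X₀) (appNode #Self (Consₒ X₁ Nilₒ))
  rule addZ     = [] ⟹ Addₒ Zₒ X₀ X₀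
  rule addS     = Addₒ X₀ X₁ X₂ ∷ [] ⟹ Addₒ (Sₒ X₀) X₁ (Sₒ X₂)
  rule triZ     = [] ⟹ Triₒ Zₒ Zₒ
  rule triS     = Triₒ X₀ X₁ ∷ Addₒ (Sₒ X₀) X₁ X₂ ∷ [] ⟹ Triₒ (Sₒ X₀) X₂
  rule pairing  = Addₒ X₀ X₁ X₂ ∷ Triₒ X₂ X₃ ∷ Addₒ X₃ X₁ X₄ ∷ [] ⟹ Pairₒ X₀ X₁ X₄
  rule valLf    = [] ⟹ Valₒ (Lfₒ X₀) X₀
  rule valNd    = Valsₒ X₀ X₁ ∷ [] ⟹ Valₒ (Ndₒ X₀) X₁
  rule valsNil  = [] ⟹ Valsₒ Nilₒ Zₒ
  rule valsCons = Valₒ X₀ X₂ ∷ Valsₒ X₁ X₃ ∷ Pairₒ X₂ X₃ X₄ ∷ [] ⟹ Valsₒ (Consₒ X₀ X₁) (Sₒ X₄)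
  rule evZf     = [] ⟹ Evₒ Zfₒ X₀ Zₒ
  rule evSf     = [] ⟹ Evₒ Sfₒ (Consₒ X₀ Nilₒ) (Sₒ X₀)
  rule evPj     = Lookupₒ X₁ X₀ X₂ ∷ [] ⟹ Evₒ (Pjₒ X₀) X₁ X₂
  rule evCp     = Evsₒ X₁ X₂ X₃ ∷ Evₒ X₀ X₃ X₄ ∷ [] ⟹ Evₒ (Cpₒ X₀ X₁) X₂ X₄
  rule evPr0    = Evₒ X₀ X₂ X₃ ∷ [] ⟹ Evₒ (Prₒ X₀ X₁) (Consₒ Zₒ X₂) X₃
  rule evPrS    = Evₒ (Prₒ X₀ X₁) (Consₒ X₂ X₃) X₄ ∷ Evₒ X₁ (Consₒ X₂ (Consₒ X₄ X₃)) X₅ ∷ []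
                  ⟹ Evₒ (Prₒ X₀ X₁) (Consₒ (Sₒ X₂) X₃) X₅
  rule evMu     = Belowₒ X₀ X₁ X₂ ∷ Evₒ X₀ (Consₒ X₂ X₁) Zₒ ∷ [] ⟹ Evₒ (Muₒ X₀) X₁ X₂
  rule evsNil   = [] ⟹ Evsₒ Nilₒ X₀ Nilₒ
  rule evsCons  = Evₒ X₀ X₂ X₃ ∷ Evsₒ X₁ X₂ X₄ ∷ [] ⟹ Evsₒ (Consₒ X₀ X₁) X₂ (Consₒ X₃ X₄)
  rule lookupZ  = [] ⟹ Lookupₒ (Consₒ X₀ X₁) Zₒ X₀
  rule lookupS  = Lookupₒ X₁ X₂ X₃ ∷ [] ⟹ Lookupₒ (Consₒ X₀ X₁) (Sₒ X₂) X₃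
  rule belowZ   = [] ⟹ Belowₒ X₀ X₁ Zₒ
  rule belowS   = Belowₒ X₀ X₁ X₂ ∷ Evₒ X₀ (Consₒ X₂ X₁) (Sₒ X₃) ∷ [] ⟹ Belowₒ X₀ X₁ (Sₒ X₂)
  rule diagonal = Selfₒ X₀ ∷ Encₒ (Selfₒ X₀) X₁ ∷ Valₒ (instanceTemplate X₁ X₀) X₂ ∷ Evₒ ⌜ d ⌝ₚ (Consₒ X₂ Nilₒ) Zₒ ∷ []
                  ⟹ BADₒ

  ruleTable : Fm
  ruleTable = ⌜ map ruleTree (tabulate rule) ⌝ₜₛ

  -- The rules cannot contain their own quotation, so the axiom supplies it and the diagonal rule
  -- rebuilds the code of the whole instance from it. The axiom is opaque: its tree quotes every
  -- rule twice over, and the type checker must never normalise it.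
  opaque
    axiom₀ : Fm
    axiom₀ = Selfₒ ruleTable

  opaque
    unfolding axiom₀
    axiom₀-self : axiom₀ ≡ Selfₒ ruleTable
    axiom₀-self = refl

  axiom₀-closed : Closed axiom₀
  axiom₀-closed = subst Closed (sym axiom₀-self) (λ σ → cong Selfₒ (⌜⌝ₜₛ-closed (map ruleTree (tabulate rule)) σ))

  calculus : Calculus Lg
  calculus = record { axioms = axiom₀ ∷ [] ; rules = tabulate rule }

  instance₀ : Instance
  instance₀ = record { lang = Lg ; calc = calculus ; logic = Mbad }

  Accepts : Set
  Accepts = Eval d (code instance₀ ∷ []) 0

  -- Arguments are only constrained where they quote the intended objects:
  -- rules may be instantiated by arbitrary formulas.
  Holds : Fm → Set
  Holds (var _)           = ⊥
  Holds BADₒ              = Accepts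
  Holds (Selfₒ ts)        = ts ≡ ruleTable
  Holds (Encₒ F t)        = t ≡ ⌜ formulaTree F ⌝ₜ
  Holds (Addₒ a b c)      = ∀ m n → a ≡ ⌜ m ⌝ₙ → b ≡ ⌜ n ⌝ₙ → c ≡ ⌜ m + n ⌝ₙ
  Holds (Triₒ a b)        = ∀ m → a ≡ ⌜ m ⌝ₙ → b ≡ ⌜ tri m ⌝ₙ
  Holds (Pairₒ a b c)     = ∀ m n → a ≡ ⌜ m ⌝ₙ → b ≡ ⌜ n ⌝ₙ → c ≡ ⌜ pair m n ⌝ₙ
  Holds (Valₒ a b)        = ∀ t → a ≡ ⌜ t ⌝ₜ → b ≡ ⌜ value t ⌝ₙ
  Holds (Valsₒ a b)       = ∀ ts → a ≡ ⌜ ts ⌝ₜₛ → b ≡ ⌜ encList (values ts) ⌝ₙ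
  Holds (Evₒ a b c)       = ∀ {n} (f : PR n) xs → a ≡ ⌜ f ⌝ₚ → b ≡ ⌜ xs ⌝ᵥ →
                            ∃[ y ] c ≡ ⌜ y ⌝ₙ × Eval f xs y
  Holds (Evsₒ a b c)      = ∀ {n m} (gs : Vec (PR n) m) xs → a ≡ ⌜ gs ⌝ₚₛ → b ≡ ⌜ xs ⌝ᵥ →
                            ∃[ ys ] c ≡ ⌜ ys ⌝ᵥ × EvalAll gs xs ys
  Holds (Lookupₒ a b c)   = ∀ {n} (xs : Vec ℕ n) i → a ≡ ⌜ xs ⌝ᵥ → b ≡ ⌜ toℕ i ⌝ₙ → c ≡ ⌜ Vec.lookup xs i ⌝ₙ
  Holds (Belowₒ a b c)    = ∀ {n} (f : PR (suc n)) xs → a ≡ ⌜ f ⌝ₚ → b ≡ ⌜ xs ⌝ᵥ →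
                            ∃[ y ] c ≡ ⌜ y ⌝ₙ × NonZeroBelow f xs y
  Holds (app _ _)         = ⊤

  holds-addZ : ∀ a → Holds (Addₒ Zₒ a a)
  holds-addZ a zero    n refl a≡n = a≡n
  holds-addZ a (suc m) n ()   _

  holds-addS : ∀ a b c → Holds (Addₒ a b c) → Holds (Addₒ (Sₒ a) b (Sₒ c))
  holds-addS a b c h zero    n ()   _
  holds-addS a b c h (suc m) n refl b≡n = cong Sₒ (h m n refl b≡n)

  holds-triZ : Holds (Triₒ Zₒ Zₒ)
  holds-triZ zero    refl = refl
  holds-triZ (suc m) ()

  holds-triS : ∀ a b c → Holds (Triₒ a b) → Holds (Addₒ (Sₒ a) b c) → Holds (Triₒ (Sₒ a) c)
  holds-triS a b c hTri hAdd zero    ()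
  holds-triS a b c hTri hAdd (suc m) refl = hAdd (suc m) (tri m) refl (hTri m refl)

  holds-pairing : ∀ a b c e f → Holds (Addₒ a b c) → Holds (Triₒ c e) → Holds (Addₒ e b f) → Holds (Pairₒ a b f)
  holds-pairing a b c e f hAdd hTri hAdd′ m n a≡m b≡n =
    hAdd′ (tri (m + n)) n (hTri (m + n) (hAdd m n a≡m b≡n)) b≡n

  holds-valLf : ∀ a → Holds (Valₒ (Lfₒ a) a)
  holds-valLf a (leaf n)  refl = refl
  holds-valLf a (node ts) ()

  holds-valNd : ∀ a b → Holds (Valsₒ a b) → Holds (Valₒ (Ndₒ a) b)
  holds-valNd a b h (leaf n)  ()
  holds-valNd a b h (node ts) refl = h ts refl

  holds-valsNil : Holds (Valsₒ Nilₒ Zₒ)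
  holds-valsNil []       refl = refl
  holds-valsNil (t ∷ ts) ()

  holds-valsCons : ∀ a b c e f → Holds (Valₒ a c) → Holds (Valsₒ b e) → Holds (Pairₒ c e f) →
                   Holds (Valsₒ (Consₒ a b) (Sₒ f))
  holds-valsCons a b c e f hVal hVals hPair []       ()
  holds-valsCons a b c e f hVal hVals hPair (t ∷ ts) refl =
    cong Sₒ (hPair (value t) (encList (values ts)) (hVal t refl) (hVals ts refl))

  holds-evZf : ∀ a → Holds (Evₒ Zfₒ a Zₒ)
  holds-evZf a zeroF       xs refl _ = 0 , refl , ev-zero
  holds-evZf a succF       xs ()   _
  holds-evZf a (proj i)    xs ()   _
  holds-evZf a (comp f gs) xs ()   _
  holds-evZf a (prec g s)  xs ()   _
  holds-evZf a (mu f)      xs ()   _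

  holds-evSf : ∀ a → Holds (Evₒ Sfₒ (Consₒ a Nilₒ) (Sₒ a))
  holds-evSf a zeroF       xs       ()   _
  holds-evSf a succF       (x ∷ []) refl refl = suc x , refl , ev-succ
  holds-evSf a (proj i)    xs       ()   _
  holds-evSf a (comp f gs) xs       ()   _
  holds-evSf a (prec g s)  xs       ()   _
  holds-evSf a (mu f)      xs       ()   _

  holds-evPj : ∀ a b c → Holds (Lookupₒ b a c) → Holds (Evₒ (Pjₒ a) b c)
  holds-evPj a b c h zeroF       xs ()   _
  holds-evPj a b c h succF       xs ()   _
  holds-evPj a b c h (proj i)    xs refl b≡xs = Vec.lookup xs i , h xs i b≡xs refl , ev-proj i
  holds-evPj a b c h (comp f gs) xs ()   _
  holds-evPj a b c h (prec g s)  xs ()   _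
  holds-evPj a b c h (mu f)      xs ()   _

  holds-evCp : ∀ a b c e f → Holds (Evsₒ b c e) → Holds (Evₒ a e f) → Holds (Evₒ (Cpₒ a b) c f)
  holds-evCp a b c e f hEvs hEv zeroF       xs ()   _
  holds-evCp a b c e f hEvs hEv succF       xs ()   _
  holds-evCp a b c e f hEvs hEv (proj i)    xs ()   _
  holds-evCp a b c e f hEvs hEv (comp g gs) xs refl c≡xs with hEvs gs xs refl c≡xs
  ... | ys , e≡ys , evs with hEv g ys refl e≡ys
  ... | y , f≡y , ev = y , f≡y , ev-comp evs ev
  holds-evCp a b c e f hEvs hEv (prec g s)  xs ()   _
  holds-evCp a b c e f hEvs hEv (mu g)      xs ()   _

  holds-evPr0 : ∀ a b c e → Holds (Evₒ a c e) → Holds (Evₒ (Prₒ a b) (Consₒ Zₒ c) e)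
  holds-evPr0 a b c e h zeroF       xs           ()   _
  holds-evPr0 a b c e h succF       xs           ()   _
  holds-evPr0 a b c e h (proj i)    xs           ()   _
  holds-evPr0 a b c e h (comp f gs) xs           ()   _
  holds-evPr0 a b c e h (prec g s)  (zero ∷ xs)  refl refl with h g xs refl refl
  ... | y , e≡y , ev = y , e≡y , ev-prec0 ev
  holds-evPr0 a b c e h (prec g s)  (suc k ∷ xs) refl ()
  holds-evPr0 a b c e h (mu f)      xs           ()   _

  holds-evPrS : ∀ a b c e f z → Holds (Evₒ (Prₒ a b) (Consₒ c e) f) → Holds (Evₒ b (Consₒ c (Consₒ f e)) z) →
                Holds (Evₒ (Prₒ a b) (Consₒ (Sₒ c) e) z)
  holds-evPrS a b c e f z hRec hStep zeroF       xs           ()   _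
  holds-evPrS a b c e f z hRec hStep succF       xs           ()   _
  holds-evPrS a b c e f z hRec hStep (proj i)    xs           ()   _
  holds-evPrS a b c e f z hRec hStep (comp h gs) xs           ()   _
  holds-evPrS a b c e f z hRec hStep (prec g s)  (zero ∷ xs)  refl ()
  holds-evPrS a b c e f z hRec hStep (prec g s)  (suc k ∷ xs) refl refl with hRec (prec g s) (k ∷ xs) refl refl
  ... | y , f≡y , ev with hStep s (k ∷ y ∷ xs) refl (cong (λ w → Consₒ ⌜ k ⌝ₙ (Consₒ w ⌜ xs ⌝ᵥ)) f≡y)
  ... | w , z≡w , ev′ = w , z≡w , ev-precS ev ev′
  holds-evPrS a b c e f z hRec hStep (mu h)      xs           ()   _

  holds-evMu : ∀ a b c → Holds (Belowₒ a b c) → Holds (Evₒ a (Consₒ c b) Zₒ) → Holds (Evₒ (Muₒ a) b c)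
  holds-evMu a b c hBelow hEv zeroF       xs ()   _
  holds-evMu a b c hBelow hEv succF       xs ()   _
  holds-evMu a b c hBelow hEv (proj i)    xs ()   _
  holds-evMu a b c hBelow hEv (comp h gs) xs ()   _
  holds-evMu a b c hBelow hEv (prec g s)  xs ()   _
  holds-evMu a b c hBelow hEv (mu f)      xs refl b≡xs with hBelow f xs refl b≡xs
  ... | y , c≡y , below with hEv f (y ∷ xs) refl (cong₂ Consₒ c≡y b≡xs)
  ... | zero  , _  , ev = y , c≡y , ev-mu ev below
  ... | suc _ , () , _

  holds-evsNil : ∀ a → Holds (Evsₒ Nilₒ a Nilₒ)
  holds-evsNil a []       xs refl _ = [] , refl , ev-[]
  holds-evsNil a (g ∷ gs) xs ()   _

  holds-evsCons : ∀ a b c e f → Holds (Evₒ a c e) → Holds (Evsₒ b c f) → Holds (Evsₒ (Consₒ a b) c (Consₒ e f))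
  holds-evsCons a b c e f hEv hEvs []       xs ()   _
  holds-evsCons a b c e f hEv hEvs (g ∷ gs) xs refl c≡xs with hEv g xs refl c≡xs | hEvs gs xs refl c≡xs
  ... | y , e≡y , ev | ys , f≡ys , evs = y ∷ ys , cong₂ Consₒ e≡y f≡ys , ev-∷ ev evs

  holds-lookupZ : ∀ a b → Holds (Lookupₒ (Consₒ a b) Zₒ a)
  holds-lookupZ a b (x ∷ xs) zero    refl _ = refl
  holds-lookupZ a b (x ∷ xs) (suc i) _    ()

  holds-lookupS : ∀ a b c e → Holds (Lookupₒ b c e) → Holds (Lookupₒ (Consₒ a b) (Sₒ c) e)
  holds-lookupS a b c e h (x ∷ xs) zero    _    ()
  holds-lookupS a b c e h (x ∷ xs) (suc i) refl refl = h xs i refl refl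

  holds-belowZ : ∀ a b → Holds (Belowₒ a b Zₒ)
  holds-belowZ a b f xs _ _ = 0 , refl , λ _ ()

  holds-belowS : ∀ a b c e → Holds (Belowₒ a b c) → Holds (Evₒ a (Consₒ c b) (Sₒ e)) → Holds (Belowₒ a b (Sₒ c))
  holds-belowS a b c e hBelow hEv f xs a≡f b≡xs with hBelow f xs a≡f b≡xs
  ... | y , c≡y , below with hEv f (y ∷ xs) a≡f (cong₂ Consₒ c≡y b≡xs)
  ... | zero  , () , _
  ... | suc w , e≡w , ev = suc y , cong Sₒ c≡y , below′
    where
    below′ : NonZeroBelow f xs (suc y)
    below′ z z<1+y with m<1+n⇒m<n∨m≡n z<1+y
    ... | inj₁ z<y  = below z z<y
    ... | inj₂ refl = w , ev

  quote-instanceTree : ⌜ instanceTree instance₀ ⌝ₜ ≡ instanceTemplate ⌜ formulaTree axiom₀ ⌝ₜ ruleTable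
  quote-instanceTree = refl

  holds-diagonal : ∀ a b c → a ≡ ruleTable → Holds (Encₒ (Selfₒ a) b) → Holds (Valₒ (instanceTemplate b a) c) →
                   Holds (Evₒ ⌜ d ⌝ₚ (Consₒ c Nilₒ) Zₒ) → Accepts
  holds-diagonal a b c a≡ruleTable hEnc hVal hEv =
    output-zero (hEv d (value (instanceTree instance₀) ∷ []) refl (cong (λ n → Consₒ n Nilₒ) c≡code))
    where
    b≡axiomTree : b ≡ ⌜ formulaTree axiom₀ ⌝ₜ
    b≡axiomTree = trans hEnc (cong (λ F → ⌜ formulaTree F ⌝ₜ) (trans (cong Selfₒ a≡ruleTable) (sym axiom₀-self)))
    c≡code : c ≡ ⌜ value (instanceTree instance₀) ⌝ₙ
    c≡code = hVal (instanceTree instance₀) (trans (cong₂ instanceTemplate b≡axiomTree a≡ruleTable) (sym quote-instanceTree))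
    output-zero : ∃[ y ] Zₒ ≡ ⌜ y ⌝ₙ × Eval d (value (instanceTree instance₀) ∷ []) y → Accepts
    output-zero (zero  , _  , ev) = subst (λ k → Eval d (k ∷ []) 0) (value-instanceTree instance₀) ev
    output-zero (suc _ , () , _)

  ruleHolds : ∀ i σ → All (λ A → Holds (A [ σ ])) (premises (rule i)) → Holds (conclusion (rule i) [ σ ])
  ruleHolds encZ     σ []                      = refl
  ruleHolds encS     σ (h ∷ [])                = cong (λ t → appNode #S (Consₒ t Nilₒ)) h
  ruleHolds encNil   σ []                      = refl
  ruleHolds encCons  σ (h ∷ h′ ∷ [])           = cong₂ (λ t t′ → appNode #Cons (Consₒ t (Consₒ t′ Nilₒ))) h h′
  ruleHolds encLf    σ (h ∷ [])                = cong (λ t → appNode #Lf (Consₒ t Nilₒ)) h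
  ruleHolds encNd    σ (h ∷ [])                = cong (λ t → appNode #Nd (Consₒ t Nilₒ)) h
  ruleHolds encSelf  σ (h ∷ [])                = cong (λ t → appNode #Self (Consₒ t Nilₒ)) h
  ruleHolds addZ     σ []                      = holds-addZ (σ 0)
  ruleHolds addS     σ (h ∷ [])                = holds-addS (σ 0) (σ 1) (σ 2) h
  ruleHolds triZ     σ []                      = holds-triZ
  ruleHolds triS     σ (h ∷ h′ ∷ [])           = holds-triS (σ 0) (σ 1) (σ 2) h h′
  ruleHolds pairing  σ (h ∷ h′ ∷ h″ ∷ [])      = holds-pairing (σ 0) (σ 1) (σ 2) (σ 3) (σ 4) h h′ h″
  ruleHolds valLf    σ []                      = holds-valLf (σ 0)
  ruleHolds valNd    σ (h ∷ [])                = holds-valNd (σ 0) (σ 1) h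
  ruleHolds valsNil  σ []                      = holds-valsNil
  ruleHolds valsCons σ (h ∷ h′ ∷ h″ ∷ [])      = holds-valsCons (σ 0) (σ 1) (σ 2) (σ 3) (σ 4) h h′ h″
  ruleHolds evZf     σ []                      = holds-evZf (σ 0)
  ruleHolds evSf     σ []                      = holds-evSf (σ 0)
  ruleHolds evPj     σ (h ∷ [])                = holds-evPj (σ 0) (σ 1) (σ 2) h
  ruleHolds evCp     σ (h ∷ h′ ∷ [])           = holds-evCp (σ 0) (σ 1) (σ 2) (σ 3) (σ 4) h h′
  ruleHolds evPr0    σ (h ∷ [])                = holds-evPr0 (σ 0) (σ 1) (σ 2) (σ 3) h
  ruleHolds evPrS    σ (h ∷ h′ ∷ [])           = holds-evPrS (σ 0) (σ 1) (σ 2) (σ 3) (σ 4) (σ 5) h h′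
  ruleHolds evMu     σ (h ∷ h′ ∷ [])           = holds-evMu (σ 0) (σ 1) (σ 2) h h′
  ruleHolds evsNil   σ []                      = holds-evsNil (σ 0)
  ruleHolds evsCons  σ (h ∷ h′ ∷ [])           = holds-evsCons (σ 0) (σ 1) (σ 2) (σ 3) (σ 4) h h′
  ruleHolds lookupZ  σ []                      = holds-lookupZ (σ 0) (σ 1)
  ruleHolds lookupS  σ (h ∷ [])                = holds-lookupS (σ 0) (σ 1) (σ 2) (σ 3) h
  ruleHolds belowZ   σ []                      = holds-belowZ (σ 0) (σ 1)
  ruleHolds belowS   σ (h ∷ h′ ∷ [])           = holds-belowS (σ 0) (σ 1) (σ 2) (σ 3) h h′
  ruleHolds diagonal σ (h ∷ h′ ∷ h″ ∷ h‴ ∷ []) = holds-diagonal (σ 0) (σ 1) (σ 2) h h′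
    (subst (λ t → Holds (Valₒ t (σ 2))) (instanceTemplate-[] X₁ X₀ σ) h″)
    (subst (λ f → Holds (Evₒ f (Consₒ (σ 2) Nilₒ) Zₒ)) (⌜⌝ₚ-closed d σ) h‴)

  infix 4 ⊢_
  ⊢_ : Fm → Set
  ⊢ F = Derivable calculus F

  mutual
    holds : ∀ {F} → ⊢ F → Holds F
    holds (by-axiom (here refl) σ) = subst Holds (sym (axiom₀-closed σ)) (subst Holds (sym axiom₀-self) refl)
    holds (by-rule r∈ σ ds) with ∈-tabulate⁻ {f = rule} r∈
    ... | i , refl = ruleHolds i σ (holdsAll ds)

    holdsAll : ∀ {σ ps} → All (λ A → ⊢ A [ σ ]) ps → All (λ A → Holds (A [ σ ])) ps
    holdsAll []       = []
    holdsAll (D ∷ Ds) = holds D ∷ holdsAll Ds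

  by : ∀ i σ → All (λ A → ⊢ A [ σ ]) (premises (rule i)) → ⊢ conclusion (rule i) [ σ ]
  by i = by-rule (∈-tabulate⁺ {f = rule} i)

  ⊢axiom₀ : ⊢ axiom₀
  ⊢axiom₀ = subst ⊢_ (axiom₀-closed (assign [])) (by-axiom (here refl) (assign []))

  ⊢Enc-numeral : ∀ n → ⊢ Encₒ ⌜ n ⌝ₙ ⌜ formulaTree ⌜ n ⌝ₙ ⌝ₜ
  ⊢Enc-numeral zero    = by encZ (assign []) []
  ⊢Enc-numeral (suc n) = by encS (assign (⌜ n ⌝ₙ ∷ ⌜ formulaTree ⌜ n ⌝ₙ ⌝ₜ ∷ [])) (⊢Enc-numeral n ∷ [])

  mutual
    ⊢Enc-tree : ∀ t → ⊢ Encₒ ⌜ t ⌝ₜ ⌜ formulaTree ⌜ t ⌝ₜ ⌝ₜ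
    ⊢Enc-tree (leaf n)  = by encLf (assign (⌜ n ⌝ₙ ∷ ⌜ formulaTree ⌜ n ⌝ₙ ⌝ₜ ∷ [])) (⊢Enc-numeral n ∷ [])
    ⊢Enc-tree (node ts) = by encNd (assign (⌜ ts ⌝ₜₛ ∷ ⌜ formulaTree ⌜ ts ⌝ₜₛ ⌝ₜ ∷ [])) (⊢Enc-trees ts ∷ [])

    ⊢Enc-trees : ∀ ts → ⊢ Encₒ ⌜ ts ⌝ₜₛ ⌜ formulaTree ⌜ ts ⌝ₜₛ ⌝ₜ
    ⊢Enc-trees []       = by encNil (assign []) []
    ⊢Enc-trees (t ∷ ts) =
      by encCons (assign (⌜ t ⌝ₜ ∷ ⌜ ts ⌝ₜₛ ∷ ⌜ formulaTree ⌜ t ⌝ₜ ⌝ₜ ∷ ⌜ formulaTree ⌜ ts ⌝ₜₛ ⌝ₜ ∷ []))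
         (⊢Enc-tree t ∷ ⊢Enc-trees ts ∷ [])

  ⊢Enc-Self : ∀ ts → ⊢ Encₒ (Selfₒ ⌜ ts ⌝ₜₛ) ⌜ formulaTree (Selfₒ ⌜ ts ⌝ₜₛ) ⌝ₜ
  ⊢Enc-Self ts = by encSelf (assign (⌜ ts ⌝ₜₛ ∷ ⌜ formulaTree ⌜ ts ⌝ₜₛ ⌝ₜ ∷ [])) (⊢Enc-trees ts ∷ [])

  ⊢Add : ∀ m n → ⊢ Addₒ ⌜ m ⌝ₙ ⌜ n ⌝ₙ ⌜ m + n ⌝ₙ
  ⊢Add zero    n = by addZ (assign (⌜ n ⌝ₙ ∷ [])) []
  ⊢Add (suc m) n = by addS (assign (⌜ m ⌝ₙ ∷ ⌜ n ⌝ₙ ∷ ⌜ m + n ⌝ₙ ∷ [])) (⊢Add m n ∷ [])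

  ⊢Tri : ∀ m → ⊢ Triₒ ⌜ m ⌝ₙ ⌜ tri m ⌝ₙ
  ⊢Tri zero    = by triZ (assign []) []
  ⊢Tri (suc m) = by triS (assign (⌜ m ⌝ₙ ∷ ⌜ tri m ⌝ₙ ∷ ⌜ tri (suc m) ⌝ₙ ∷ [])) (⊢Tri m ∷ ⊢Add (suc m) (tri m) ∷ [])

  ⊢Pair : ∀ m n → ⊢ Pairₒ ⌜ m ⌝ₙ ⌜ n ⌝ₙ ⌜ pair m n ⌝ₙ
  ⊢Pair m n = by pairing (assign (⌜ m ⌝ₙ ∷ ⌜ n ⌝ₙ ∷ ⌜ m + n ⌝ₙ ∷ ⌜ tri (m + n) ⌝ₙ ∷ ⌜ pair m n ⌝ₙ ∷ []))
                 (⊢Add m n ∷ ⊢Tri (m + n) ∷ ⊢Add (tri (m + n)) n ∷ [])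

  mutual
    ⊢Val : ∀ t → ⊢ Valₒ ⌜ t ⌝ₜ ⌜ value t ⌝ₙ
    ⊢Val (leaf n)  = by valLf (assign (⌜ n ⌝ₙ ∷ [])) []
    ⊢Val (node ts) = by valNd (assign (⌜ ts ⌝ₜₛ ∷ ⌜ encList (values ts) ⌝ₙ ∷ [])) (⊢Vals ts ∷ [])

    ⊢Vals : ∀ ts → ⊢ Valsₒ ⌜ ts ⌝ₜₛ ⌜ encList (values ts) ⌝ₙ
    ⊢Vals []       = by valsNil (assign []) []
    ⊢Vals (t ∷ ts) =
      by valsCons (assign (⌜ t ⌝ₜ ∷ ⌜ ts ⌝ₜₛ ∷ ⌜ value t ⌝ₙ ∷ ⌜ encList (values ts) ⌝ₙ ∷ ⌜ pair (value t) (encList (values ts)) ⌝ₙ ∷ []))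
         (⊢Val t ∷ ⊢Vals ts ∷ ⊢Pair (value t) (encList (values ts)) ∷ [])

  ⊢Lookup : ∀ {n} (xs : Vec ℕ n) i → ⊢ Lookupₒ ⌜ xs ⌝ᵥ ⌜ toℕ i ⌝ₙ ⌜ Vec.lookup xs i ⌝ₙ
  ⊢Lookup (x ∷ xs) zero    = by lookupZ (assign (⌜ x ⌝ₙ ∷ ⌜ xs ⌝ᵥ ∷ [])) []
  ⊢Lookup (x ∷ xs) (suc i) =
    by lookupS (assign (⌜ x ⌝ₙ ∷ ⌜ xs ⌝ᵥ ∷ ⌜ toℕ i ⌝ₙ ∷ ⌜ Vec.lookup xs i ⌝ₙ ∷ [])) (⊢Lookup xs i ∷ [])

  mutual
    ⊢Ev : ∀ {n} {f : PR n} {xs y} → Eval f xs y → ⊢ Evₒ ⌜ f ⌝ₚ ⌜ xs ⌝ᵥ ⌜ y ⌝ₙ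
    ⊢Ev {xs = xs} ev-zero = by evZf (assign (⌜ xs ⌝ᵥ ∷ [])) []
    ⊢Ev (ev-succ {x}) = by evSf (assign (⌜ x ⌝ₙ ∷ [])) []
    ⊢Ev {xs = xs} (ev-proj i) =
      by evPj (assign (⌜ toℕ i ⌝ₙ ∷ ⌜ xs ⌝ᵥ ∷ ⌜ Vec.lookup xs i ⌝ₙ ∷ [])) (⊢Lookup xs i ∷ [])
    ⊢Ev (ev-comp {f = f} {gs} {xs} {ys} {y} evs ev) =
      by evCp (assign (⌜ f ⌝ₚ ∷ ⌜ gs ⌝ₚₛ ∷ ⌜ xs ⌝ᵥ ∷ ⌜ ys ⌝ᵥ ∷ ⌜ y ⌝ₙ ∷ [])) (⊢Evs evs ∷ ⊢Ev ev ∷ [])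
    ⊢Ev (ev-prec0 {g = g} {s} {xs} {y} ev) =
      by evPr0 (assign (⌜ g ⌝ₚ ∷ ⌜ s ⌝ₚ ∷ ⌜ xs ⌝ᵥ ∷ ⌜ y ⌝ₙ ∷ [])) (⊢Ev ev ∷ [])
    ⊢Ev (ev-precS {g = g} {s} {xs} {k} {y} {z} ev ev′) =
      by evPrS (assign (⌜ g ⌝ₚ ∷ ⌜ s ⌝ₚ ∷ ⌜ k ⌝ₙ ∷ ⌜ xs ⌝ᵥ ∷ ⌜ y ⌝ₙ ∷ ⌜ z ⌝ₙ ∷ [])) (⊢Ev ev ∷ ⊢Ev ev′ ∷ [])
    ⊢Ev (ev-mu {f = f} {xs} {y} ev below) =
      by evMu (assign (⌜ f ⌝ₚ ∷ ⌜ xs ⌝ᵥ ∷ ⌜ y ⌝ₙ ∷ [])) (⊢Below f xs below y ≤-refl ∷ ⊢Ev ev ∷ [])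

    ⊢Evs : ∀ {n m} {gs : Vec (PR n) m} {xs ys} → EvalAll gs xs ys → ⊢ Evsₒ ⌜ gs ⌝ₚₛ ⌜ xs ⌝ᵥ ⌜ ys ⌝ᵥ
    ⊢Evs {xs = xs} ev-[] = by evsNil (assign (⌜ xs ⌝ᵥ ∷ [])) []
    ⊢Evs (ev-∷ {g = g} {gs} {xs} {y} {ys} ev evs) =
      by evsCons (assign (⌜ g ⌝ₚ ∷ ⌜ gs ⌝ₚₛ ∷ ⌜ xs ⌝ᵥ ∷ ⌜ y ⌝ₙ ∷ ⌜ ys ⌝ᵥ ∷ [])) (⊢Ev ev ∷ ⊢Evs evs ∷ [])

    ⊢Below : ∀ {n} (f : PR (suc n)) xs {y} → NonZeroBelow f xs y → ∀ k → k ≤ y → ⊢ Belowₒ ⌜ f ⌝ₚ ⌜ xs ⌝ᵥ ⌜ k ⌝ₙ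
    ⊢Below f xs below zero    _   = by belowZ (assign (⌜ f ⌝ₚ ∷ ⌜ xs ⌝ᵥ ∷ [])) []
    ⊢Below f xs below (suc k) k<y =
      by belowS (assign (⌜ f ⌝ₚ ∷ ⌜ xs ⌝ᵥ ∷ ⌜ k ⌝ₙ ∷ ⌜ proj₁ (below k k<y) ⌝ₙ ∷ []))
         (⊢Below f xs below k (<⇒≤ k<y) ∷ ⊢Ev (proj₂ (below k k<y)) ∷ [])

  -- The code is kept abstract: unfolding the numeral ⌜ code instance₀ ⌝ₙ is infeasible.
  ⊢BAD-with-code : ∀ k → Eval d (k ∷ []) 0 → ⊢ Valₒ ⌜ instanceTree instance₀ ⌝ₜ ⌜ k ⌝ₙ → ⊢ BADₒ
  ⊢BAD-with-code k accepts ⊢code = by diagonal σ (⊢Self ∷ ⊢Enc ∷ ⊢Val′ ∷ ⊢Ev′ ∷ [])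
    where
    σ : Substitution Lg
    σ = assign (ruleTable ∷ ⌜ formulaTree axiom₀ ⌝ₜ ∷ ⌜ k ⌝ₙ ∷ [])
    ⊢Self : ⊢ Selfₒ ruleTable
    ⊢Self = subst ⊢_ axiom₀-self ⊢axiom₀
    ⊢Enc : ⊢ Encₒ (Selfₒ ruleTable) ⌜ formulaTree axiom₀ ⌝ₜ
    ⊢Enc = subst (λ F → ⊢ Encₒ (Selfₒ ruleTable) ⌜ formulaTree F ⌝ₜ) (sym axiom₀-self)
                 (⊢Enc-Self (map ruleTree (tabulate rule)))
    ⊢Val′ : ⊢ Valₒ (instanceTemplate X₁ X₀ [ σ ]) ⌜ k ⌝ₙ
    ⊢Val′ = subst (λ t → ⊢ Valₒ t ⌜ k ⌝ₙ) (trans quote-instanceTree (sym (instanceTemplate-[] X₁ X₀ σ))) ⊢code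
    ⊢Ev′ : ⊢ Evₒ (⌜ d ⌝ₚ [ σ ]) (Consₒ ⌜ k ⌝ₙ Nilₒ) Zₒ
    ⊢Ev′ = subst (λ f → ⊢ Evₒ f (Consₒ ⌜ k ⌝ₙ Nilₒ) Zₒ) (sym (⌜⌝ₚ-closed d σ)) (⊢Ev accepts)

  ⊢BAD : Accepts → ⊢ BADₒ
  ⊢BAD accepts = ⊢BAD-with-code (value (instanceTree instance₀))
    (subst (λ k → Eval d (k ∷ []) 0) (sym (value-instanceTree instance₀)) accepts) (⊢Val (instanceTree instance₀))

  holds⇒taut : ∀ F → Holds F → ¬ Accepts → Taut Mbad F
  holds⇒taut (var _)         ()      _
  holds⇒taut BADₒ            accepts ¬accepts = ⊥-elim (¬accepts accepts)
  holds⇒taut (app (suc _) _) _       _        = λ _ → refl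

  sound⇒¬accepts : WeaklySound calculus Mbad → ¬ Accepts
  sound⇒¬accepts sound accepts =
    BAD-undesignated (λ _ → zero) (sound BADₒ (derivable⇒Thm calculus (⊢BAD accepts)) (λ _ → zero))

  rejects⇒sound : Eval d (code instance₀ ∷ []) 1 → WeaklySound calculus Mbad
  rejects⇒sound rejects F thm =
    holds⇒taut F (holds (Thm⇒derivable calculus thm)) (λ accepts → 0≢1+n (Eval-deterministic accepts rejects))

proposition3 : ¬ (Σ (PR 1) λ d → DecidesWeakSoundness d)
proposition3 (d , decides) = unsound (rejects⇒sound (proj₂ (decides instance₀) unsound))
  where
  open Diagonal d
  unsound : ¬ WeaklySound calculus Mbad
  unsound sound = sound⇒¬accepts sound (proj₁ (decides instance₀) sound)
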